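{- Let $p\ge1$, $s\ge1$, and let $(\mathbf{d},\mathbf{r})$ be a smooth arithmetical structure on $\mathcal{CT}(p,s)$. Then $d_p>1$ if and only if $r_p<\sum_{j=1}^{s}r_{\ell_j}$.
   Context: The coconut tree $\mathcal{CT}(p,s)$ is the graph with vertices $v_1,\dots,v_p,v_{\ell_1},\dots,v_{\ell_s}$ and edges $v_iv_{i+1}$ ($1\le i\le p-1$) and $v_pv_{\ell_j}$ ($1\le j\le s$). An arithmetical structure on a finite connected simple graph is a pair $(\mathbf{d},\mathbf{r})$ of vectors of positive integers indexed by the vertices such that for every vertex $v$, $d_vr_v$ equals the sum of $r_u$ over the neighbors $u$ of $v$, and the entries of $\mathbf{r}$ have gcd $1$. On $\mathcal{CT}(p,s)$ write $\mathbf{r}=(r_1,\dots,r_p,r_{\ell_1},\dots,r_{\ell_s})$ and $\mathbf{d}=(d_1,\dots,d_p,d_{\ell_1},\dots,d_{\ell_s})$. The structure is smooth if $d_1,\dots,d_{p-1},d_{\ell_1},\dots,d_{\ell_s}\ge2$. -}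

module Defs where

open import Data.Nat using (ℕ; zero; suc; _+_; _*_; _≤_; _<_; _≥_; _≡ᵇ_)
open import Data.Nat.Divisibility using (_∣_)
open import Data.Product using (_×_)
open import Data.Fin using (Fin; toℕ; splitAt; _↑ˡ_; _↑ʳ_; fromℕ)
open import Data.Bool using (Bool; true; false; if_then_else_; _∨_; _∧_)
open import Data.Sum using (inj₁; inj₂)
open import Relation.Binary.PropositionalEquality using (_≡_)
open import Data.Vec.Functional using () renaming (foldr to vfoldr)

Graph : ℕ → Set
Graph n = Fin n → Fin n → Bool

sumFin : {n : ℕ} → (Fin n → ℕ) → ℕ
sumFin f = vfoldr _+_ 0 f

neighbourSum : {n : ℕ} → Graph n → (Fin n → ℕ) → Fin n → ℕ
neighbourSum G r v = sumFin (λ u → if G v u then r u else 0)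

GcdOne : {n : ℕ} → (Fin n → ℕ) → Set
GcdOne {n} r = (k : ℕ) → ((v : Fin n) → k ∣ r v) → k ∣ 1

record IsArithmetical {n : ℕ} (G : Graph n) (d r : Fin n → ℕ) : Set where
  field
    d-pos   : (v : Fin n) → 1 ≤ d v
    r-pos   : (v : Fin n) → 1 ≤ r v
    balance : (v : Fin n) → d v * r v ≡ neighbourSum G r v
    gcd-one : GcdOne r

-- Coconut tree CT(p,s) on Fin (p + s):
--   vertex  i ↑ˡ s  (i : Fin p, toℕ i = k)  is the path vertex v_{k+1},
--   vertex  p ↑ʳ j  (j : Fin s)             is the leaf v_{ℓ_{j+1}}.
-- Edges: v_i v_{i+1}, and v_p v_{ℓ_j}  (v_p has toℕ index p - 1, i.e. suc (toℕ i) ≡ p).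
ctAdj : (p s : ℕ) → Fin (p + s) → Fin (p + s) → Bool
ctAdj p s x y with splitAt p x | splitAt p y
... | inj₁ i | inj₁ j = (suc (toℕ i) ≡ᵇ toℕ j) ∨ (suc (toℕ j) ≡ᵇ toℕ i)
... | inj₁ i | inj₂ _ = suc (toℕ i) ≡ᵇ p
... | inj₂ _ | inj₁ j = suc (toℕ j) ≡ᵇ p
... | inj₂ _ | inj₂ _ = false

CT : (p s : ℕ) → Graph (p + s)
CT = ctAdj

pathV : {p : ℕ} (s : ℕ) → Fin p → Fin (p + s)
pathV s i = i ↑ˡ s

leafV : (p : ℕ) {s : ℕ} → Fin s → Fin (p + s)
leafV p j = p ↑ʳ j

IsSmoothCT : (p s : ℕ) → (Fin (p + s) → ℕ) → Set
IsSmoothCT p s d =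
  ((i : Fin p) → suc (toℕ i) < p → 2 ≤ d (pathV s i)) × ((j : Fin s) → 2 ≤ d (leafV p j))

lastPathV : (q s : ℕ) → Fin (suc q + s)
lastPathV q s = pathV s (fromℕ q)

{-# OPTIONS --safe #-}
-- Put r_0 = 0. For 1 ≤ i < p the balance at v_i reads d_i r_i = r_{i-1} + r_{i+1}, so
-- d_i ≥ 2 makes r_0, r_1, …, r_p convex, hence strictly increasing since r_0 < r_1.
-- At v_p the balance reads d_p r_p = r_{p-1} + Σ_j r_{ℓ_j} with r_{p-1} < r_p: so
-- d_p ≥ 2 forces r_p < Σ_j r_{ℓ_j}, while d_p ≤ 1 forces r_p ≥ Σ_j r_{ℓ_j}.
module Submission where

open import Defs
open import Data.Nat using (ℕ; suc; _+_; _≤_; _<_)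
open import Data.Fin using (Fin)
open import Function.Bundles using (_⇔_)

open import Data.Bool using (Bool; true; false; if_then_else_; _∨_)
open import Data.Fin using (toℕ; fromℕ; fromℕ<; _↑ˡ_; _↑ʳ_)
  renaming (zero to fzero; suc to fsuc)
open import Data.Fin.Properties using (splitAt-↑ˡ; splitAt-↑ʳ; toℕ-fromℕ; toℕ-fromℕ<)
open import Data.Nat using (zero; _*_; _≡ᵇ_; _≟_; _≤?_; s≤s)
open import Data.Nat.Properties
open import Algebra.Properties.CommutativeMonoid.Sum +-0-commutativeMonoid
  using (sum-cong-≗; ∑-distrib-+; sum-replicate-zero)
open import Data.Product using (proj₁)
open import Function.Base using (_∘_)
open import Function.Bundles using (mk⇔)
open import Relation.Binary.PropositionalEquality
open import Relation.Nullary using (yes; no; contradiction)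
open import Relation.Nullary.Decidable using (dec-true; dec-false)

sumFin-↑ˡ-↑ʳ : ∀ {p s} (f : Fin (p + s) → ℕ) →
  sumFin f ≡ sumFin (f ∘ (_↑ˡ s)) + sumFin (f ∘ (p ↑ʳ_))
sumFin-↑ˡ-↑ʳ {zero}  f = refl
sumFin-↑ˡ-↑ʳ {suc p} {s} f = begin
  f fzero + sumFin (f ∘ fsuc)
    ≡⟨ cong (f fzero +_) (sumFin-↑ˡ-↑ʳ {p} (f ∘ fsuc)) ⟩
  f fzero + (sumFin (f ∘ fsuc ∘ (_↑ˡ s)) + sumFin (f ∘ (suc p ↑ʳ_)))
    ≡⟨ +-assoc (f fzero) _ _ ⟨
  sumFin (f ∘ (_↑ˡ s)) + sumFin (f ∘ (suc p ↑ʳ_)) ∎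
  where open ≡-Reasoning

sumFin-if : ∀ {n} (b : Bool) (f : Fin n → ℕ) →
  sumFin (λ j → if b then f j else 0) ≡ (if b then sumFin f else 0)
sumFin-if true      f = refl
sumFin-if {n} false f = sum-replicate-zero n

-- padded g is the sequence 0, g 0, g 1, …, g (n - 1), 0, 0, …
padded : ∀ {n} → (Fin n → ℕ) → ℕ → ℕ
padded         g zero          = 0
padded {zero}  g (suc a)       = 0
padded {suc n} g (suc zero)    = g fzero
padded {suc n} g (suc (suc a)) = padded (g ∘ fsuc) (suc a)

padded-toℕ : ∀ {n} (g : Fin n → ℕ) (i : Fin n) → padded g (suc (toℕ i)) ≡ g i
padded-toℕ g fzero    = refl
padded-toℕ g (fsuc i) = padded-toℕ (g ∘ fsuc) i

padded-> : ∀ {n} (g : Fin n → ℕ) {a} → n < a → padded g a ≡ 0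
padded-> {zero}  g {suc a}       _               = refl
padded-> {suc n} g {suc (suc a)} (s≤s (s≤s n≤a)) = padded-> (g ∘ fsuc) (s≤s n≤a)

sumFin-indicator : ∀ {n} (g : Fin n → ℕ) (a : ℕ) →
  sumFin (λ j → if suc (toℕ j) ≡ᵇ a then g j else 0) ≡ padded g a
sumFin-indicator {zero}  g zero          = refl
sumFin-indicator {zero}  g (suc a)       = refl
sumFin-indicator {suc n} g zero          = sum-replicate-zero (suc n)
sumFin-indicator {suc n} g (suc zero)    =
  trans (cong (g fzero +_) (sum-replicate-zero n)) (+-identityʳ (g fzero))
sumFin-indicator {suc n} g (suc (suc a)) = sumFin-indicator (g ∘ fsuc) (suc a)

-- v_{m+1} is adjacent to v_{k+1} iff m = k + 1 or m + 1 = k, and never both.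
if-adjacent : ∀ k m x →
  (if (suc k ≡ᵇ m) ∨ (suc m ≡ᵇ k) then x else 0) ≡
  (if m ≡ᵇ suc k then x else 0) + (if suc m ≡ᵇ k then x else 0)
if-adjacent zero    zero          x = refl
if-adjacent zero    (suc zero)    x = sym (+-identityʳ x)
if-adjacent zero    (suc (suc m)) x = refl
if-adjacent (suc k) zero          x = refl
if-adjacent (suc k) (suc m)       x = if-adjacent k m x

2*m≤o+n∧n<m⇒m<o : ∀ {m n o} → 2 * m ≤ o + n → n < m → m < o
2*m≤o+n∧n<m⇒m<o {m} {n} {o} 2m≤o+n n<m with m <? o
... | yes m<o = m<o
... | no  m≮o = contradiction 2m≤o+n (<⇒≱ (begin-strict
  o + n  <⟨ +-mono-≤-< (≮⇒≥ m≮o) n<m ⟩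
  m + m  ≡⟨ cong (m +_) (+-identityʳ m) ⟨
  2 * m  ∎))
  where open ≤-Reasoning

convex⇒strictlyIncreasing : (a : ℕ → ℕ) {n : ℕ} → a 0 < a 1 →
  (∀ m → suc m < n → 2 * a (suc m) ≤ a (suc (suc m)) + a m) →
  ∀ m → m < n → a m < a (suc m)
convex⇒strictlyIncreasing a a₀<a₁ convex zero    _       = a₀<a₁
convex⇒strictlyIncreasing a a₀<a₁ convex (suc m) 1+m<n =
  2*m≤o+n∧n<m⇒m<o (convex m 1+m<n)
    (convex⇒strictlyIncreasing a a₀<a₁ convex m (<-trans (n<1+n m) 1+m<n))

m*n≡o+p∧o<n⇒1<m⇔n<p : ∀ {m n o p} → m * n ≡ o + p → o < n → (1 < m ⇔ n < p)
m*n≡o+p∧o<n⇒1<m⇔n<p {m} {n} {o} {p} mn≡o+p o<n = mk⇔ forward backward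
  where
  open ≤-Reasoning
  forward : 1 < m → n < p
  forward 1<m = 2*m≤o+n∧n<m⇒m<o (begin
    2 * n  ≤⟨ *-monoˡ-≤ n 1<m ⟩
    m * n  ≡⟨ mn≡o+p ⟩
    o + p  ≡⟨ +-comm o p ⟩
    p + o  ∎) o<n
  backward : n < p → 1 < m
  backward n<p with m ≤? 1
  ... | no  m≰1 = ≰⇒> m≰1
  ... | yes m≤1 = contradiction (begin
    p      ≤⟨ m≤n+m p o ⟩
    o + p  ≡⟨ mn≡o+p ⟨
    m * n  ≤⟨ *-monoˡ-≤ n m≤1 ⟩
    1 * n  ≡⟨ *-identityˡ n ⟩
    n      ∎) (<⇒≱ n<p)

module CoconutTree (q s : ℕ) where

  p : ℕ
  p = suc q

  -- pathWeight r k is r at v_k, with phantom vertices v_0, v_{p+1}, v_{p+2}, … of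
  -- weight 0, so that every path vertex has the same shape of balance equation.

  pathWeight : (Fin (p + s) → ℕ) → ℕ → ℕ
  pathWeight r = padded (r ∘ pathV s)

  leafSum : (Fin (p + s) → ℕ) → ℕ
  leafSum r = sumFin (r ∘ leafV p)

  neighbourSum-pathV : (r : Fin (p + s) → ℕ) (i : Fin p) →
    neighbourSum (CT p s) r (pathV s i) ≡
    pathWeight r (suc (suc (toℕ i))) + pathWeight r (toℕ i) +
      (if suc (toℕ i) ≡ᵇ p then leafSum r else 0)
  neighbourSum-pathV r i = begin
    neighbourSum (CT p s) r (pathV s i)
      ≡⟨ sumFin-↑ˡ-↑ʳ {p} {s} (λ u → if CT p s (pathV s i) u then r u else 0) ⟩
    sumFin (λ j → if CT p s (pathV s i) (pathV s j) then R j else 0) +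
      sumFin (λ j → if CT p s (pathV s i) (leafV p j) then r (leafV p j) else 0)
      ≡⟨ cong₂ _+_ (sum-cong-≗ pathTerm) (sum-cong-≗ leafTerm) ⟩
    sumFin (λ j → (if toℕ j ≡ᵇ suc k then R j else 0) + (if suc (toℕ j) ≡ᵇ k then R j else 0)) +
      sumFin (λ j → if suc k ≡ᵇ p then r (leafV p j) else 0)
      ≡⟨ cong₂ _+_ (∑-distrib-+ (λ j → if toℕ j ≡ᵇ suc k then R j else 0)
                                 (λ j → if suc (toℕ j) ≡ᵇ k then R j else 0))
                   (sumFin-if (suc k ≡ᵇ p) (r ∘ leafV p)) ⟩
    sumFin (λ j → if suc (toℕ j) ≡ᵇ suc (suc k) then R j else 0) +
      sumFin (λ j → if suc (toℕ j) ≡ᵇ k then R j else 0) +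
      (if suc k ≡ᵇ p then leafSum r else 0)
      ≡⟨ cong (_+ (if suc k ≡ᵇ p then leafSum r else 0))
              (cong₂ _+_ (sumFin-indicator R (suc (suc k))) (sumFin-indicator R k)) ⟩
    pathWeight r (suc (suc k)) + pathWeight r k + (if suc k ≡ᵇ p then leafSum r else 0) ∎
    where
    open ≡-Reasoning
    k = toℕ i
    R = r ∘ pathV s
    pathTerm : ∀ j → (if CT p s (pathV s i) (pathV s j) then R j else 0) ≡
      (if toℕ j ≡ᵇ suc k then R j else 0) + (if suc (toℕ j) ≡ᵇ k then R j else 0)
    pathTerm j rewrite splitAt-↑ˡ p i s | splitAt-↑ˡ p j s = if-adjacent k (toℕ j) (R j)
    leafTerm : ∀ j → (if CT p s (pathV s i) (leafV p j) then r (leafV p j) else 0) ≡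
      (if suc k ≡ᵇ p then r (leafV p j) else 0)
    leafTerm j rewrite splitAt-↑ˡ p i s | splitAt-↑ʳ p s j = refl

  module _ {d r : Fin (p + s) → ℕ} (ar : IsArithmetical (CT p s) d r) where
    open IsArithmetical ar

    pathBalance : (i : Fin p) →
      d (pathV s i) * pathWeight r (suc (toℕ i)) ≡
      pathWeight r (suc (suc (toℕ i))) + pathWeight r (toℕ i) +
        (if suc (toℕ i) ≡ᵇ p then leafSum r else 0)
    pathBalance i = begin
      d v * pathWeight r (suc (toℕ i))  ≡⟨ cong (d v *_) (padded-toℕ (r ∘ pathV s) i) ⟩
      d v * r v                          ≡⟨ balance v ⟩
      neighbourSum (CT p s) r v          ≡⟨ neighbourSum-pathV r i ⟩
      pathWeight r (suc (suc (toℕ i))) + pathWeight r (toℕ i) +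
        (if suc (toℕ i) ≡ᵇ p then leafSum r else 0) ∎
      where
      open ≡-Reasoning
      v = pathV s i

    pathWeight-convex : IsSmoothCT p s d →
      ∀ m → suc m < p → 2 * pathWeight r (suc m) ≤ pathWeight r (suc (suc m)) + pathWeight r m
    pathWeight-convex smooth m 1+m<p
      with fromℕ< (<-trans (n<1+n m) 1+m<p) | toℕ-fromℕ< (<-trans (n<1+n m) 1+m<p)
    ... | i | refl = begin
      2 * a (suc m)                   ≤⟨ *-monoˡ-≤ (a (suc m)) (proj₁ smooth i 1+m<p) ⟩
      d (pathV s i) * a (suc m)       ≡⟨ pathBalance i ⟩
      a (suc (suc m)) + a m + (if suc m ≡ᵇ p then leafSum r else 0)
        ≡⟨ cong (λ b → a (suc (suc m)) + a m + (if b then leafSum r else 0))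
                (dec-false (suc m ≟ p) (<⇒≢ 1+m<p)) ⟩
      a (suc (suc m)) + a m + 0       ≡⟨ +-identityʳ _ ⟩
      a (suc (suc m)) + a m           ∎
      where
      open ≤-Reasoning
      a = pathWeight r

    lastBalance : d (lastPathV q s) * r (lastPathV q s) ≡ pathWeight r q + leafSum r
    lastBalance = begin
      d v * r v                   ≡⟨ cong (d v *_) (padded-toℕ (r ∘ pathV s) (fromℕ q)) ⟨
      d v * pathWeight r (suc t)  ≡⟨ pathBalance (fromℕ q) ⟩
      pathWeight r (suc (suc t)) + pathWeight r t + (if suc t ≡ᵇ p then leafSum r else 0)
        ≡⟨ cong (λ k → pathWeight r (suc (suc k)) + pathWeight r k + (if suc k ≡ᵇ p then leafSum r else 0))
                (toℕ-fromℕ q) ⟩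
      pathWeight r (suc p) + pathWeight r q + (if p ≡ᵇ p then leafSum r else 0)
        ≡⟨ cong₂ (λ x b → x + pathWeight r q + (if b then leafSum r else 0))
                 (padded-> (r ∘ pathV s) ≤-refl) (dec-true (p ≟ p) refl) ⟩
      pathWeight r q + leafSum r         ∎
      where
      open ≡-Reasoning
      v = lastPathV q s
      t = toℕ (fromℕ q)

    pathWeight-pred<lastPathV : IsSmoothCT p s d → pathWeight r q < r (lastPathV q s)
    pathWeight-pred<lastPathV smooth = begin-strict
      pathWeight r q  <⟨ increasing q ≤-refl ⟩
      pathWeight r p  ≡⟨ cong (pathWeight r ∘ suc) (toℕ-fromℕ q) ⟨
      pathWeight r (suc (toℕ (fromℕ q)))  ≡⟨ padded-toℕ (r ∘ pathV s) (fromℕ q) ⟩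
      r (lastPathV q s) ∎
      where
      open ≤-Reasoning
      increasing : ∀ m → m < p → pathWeight r m < pathWeight r (suc m)
      increasing = convex⇒strictlyIncreasing (pathWeight r) (r-pos (pathV s fzero))
                     (pathWeight-convex smooth)

proposition4p21 : (q s : ℕ) → 1 ≤ s →
    (d r : Fin (suc q + s) → ℕ) →
    IsArithmetical (CT (suc q) s) d r → IsSmoothCT (suc q) s d →
    (1 < d (lastPathV q s)) ⇔ (r (lastPathV q s) < sumFin (λ (j : Fin s) → r (leafV (suc q) j)))
proposition4p21 q s _ d r ar smooth =
  m*n≡o+p∧o<n⇒1<m⇔n<p (lastBalance ar) (pathWeight-pred<lastPathV ar smooth)
  where open CoconutTree q s
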